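{- Let $\alpha,\beta$ be coprime positive integers and $\lambda$ a partition with departure words $\{w^{i}(\lambda)\}_{i\ge0}$. Then \[ h_{\alpha,\beta}(\lambda)=\sum_{i\geq0} \operatorname{inv}(w^{i}(\lambda)), \] where $\operatorname{inv}(w)$ is the number of pairs of positions $p<p'$ in the word $w$ with the letter at $p$ equal to $E$ and the letter at $p'$ equal to $N$.
   Context: For a cell $v$ of a Young diagram, $a_v$ is the number of cells to its right in its row and $l_v$ the number of cells below it in its column. $h_{\alpha,\beta}(\lambda)$ is the number of cells $v$ of $\lambda$ with $\alpha l_v=\beta(a_v+1)$ and $(\alpha+\beta)\mid a_v+l_v+1$. Place the Young diagram so that cell $(i,j)$ (row $i$, column $j$) is the unit square $[j-1,j]\times[-i,-i+1]$. The $(\alpha,\beta)$-label of cell $(i,j)$ is $\alpha i+\beta j$; the $k$-th level is the line $\beta x-\alpha y=k$. The order $n_\lambda$ is the smallest $n\ge0$ such that every cell of $\lambda$ has $(\alpha,\beta)$-label at most $\alpha\beta n$. The border path of $\lambda$ is the lattice path with unit north and east steps from $(0,-\beta n_\lambda)$ to $(\alpha n_\lambda,0)$ tracing the boundary of $\lambda$ (up the $y$-axis, along the lower-right boundary of the diagram, then along the $x$-axis). The departure words: start with all $w^i$ empty, traverse the border path, and at each lattice point of the path other than the last, if the point lies on level $\alpha\beta n_\lambda-i$, append to $w^i$ the letter $N$ if the next step is north and $E$ if it is east. -}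

module Defs where

open import Data.Nat using (ℕ; zero; suc; _+_; _*_; _∸_; _≤_; _<_; _≤?_; _≟_)
open import Data.Nat.Divisibility using (_∣_; _∣?_)
open import Data.List using (List; []; _∷_; _++_; length; filter; replicate; reverse; map; upTo; foldr)
open import Data.Nat.ListAction using (sum)
open import Data.List.Relation.Unary.All using (All; all?)
open import Data.Product using (_×_; _,_)
open import Relation.Nullary using (Dec; yes; no; ¬_)
open import Relation.Nullary.Decidable using (⌊_⌋; _×-dec_)
open import Relation.Binary.PropositionalEquality using (_≡_)
open import Data.Bool using (Bool; true; false; if_then_else_)

data Decreasing : List ℕ → Set where
  []  : Decreasing []
  [-] : ∀ {x} → Decreasing (x ∷ [])
  _∷_ : ∀ {x y ys} → y ≤ x → Decreasing (y ∷ ys) → Decreasing (x ∷ y ∷ ys)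

IsPartition : List ℕ → Set
IsPartition λs = Decreasing λs × All (λ p → 1 ≤ p) λs

-- Cells (i , j): row i, column j, both 1-based.

rowCells : ℕ → ℕ → List (ℕ × ℕ)
rowCells i p = map (λ j → (i , suc j)) (upTo p)

cellsFrom : ℕ → List ℕ → List (ℕ × ℕ)
cellsFrom i []       = []
cellsFrom i (p ∷ ps) = rowCells i p ++ cellsFrom (suc i) ps

cells : List ℕ → List (ℕ × ℕ)
cells λs = cellsFrom 1 λs

-- length of row i (1-based), 0 if i exceeds the number of rows
rowLen : List ℕ → ℕ → ℕ
rowLen []       _             = 0
rowLen (p ∷ ps) zero          = 0
rowLen (p ∷ ps) (suc zero)    = p
rowLen (p ∷ ps) (suc (suc i)) = rowLen ps (suc i)

colLen : List ℕ → ℕ → ℕ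
colLen λs j = length (filter (λ p → j ≤? p) λs)

arm : List ℕ → ℕ × ℕ → ℕ
arm λs (i , j) = rowLen λs i ∸ j

leg : List ℕ → ℕ × ℕ → ℕ
leg λs (i , j) = colLen λs j ∸ i

hCond : ℕ → ℕ → List ℕ → ℕ × ℕ → Set
hCond α β λs v = (α * leg λs v ≡ β * (arm λs v + 1)) × ((α + β) ∣ (arm λs v + leg λs v + 1))

hCond? : ∀ α β λs v → Dec (hCond α β λs v)
hCond? α β λs v = (α * leg λs v ≟ β * (arm λs v + 1)) ×-dec ((α + β) ∣? (arm λs v + leg λs v + 1))

h : ℕ → ℕ → List ℕ → ℕ
h α β λs = length (filter (hCond? α β λs) (cells λs))

label : ℕ → ℕ → ℕ × ℕ → ℕ
label α β (i , j) = α * i + β * j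

labelsBelow : ℕ → ℕ → List ℕ → ℕ → Bool
labelsBelow α β λs n = ⌊ all? (λ v → label α β v ≤? α * β * n) (cells λs) ⌋

searchOrder : ℕ → ℕ → List ℕ → ℕ → ℕ → ℕ
searchOrder α β λs zero       start = start
searchOrder α β λs (suc fuel) start =
  if labelsBelow α β λs start then start else searchOrder α β λs fuel (suc start)

maxLabel : ℕ → ℕ → List ℕ → ℕ
maxLabel α β λs = foldr (λ v m → label α β v Data.Nat.⊔ m) 0 (cells λs)

-- n_λ: the smallest n ≥ 0 such that every cell has label ≤ α β n.
-- (For α, β ≥ 1, n = maxLabel already works, so the search with this
-- fuel returns the least such n.)
order : ℕ → ℕ → List ℕ → ℕ
order α β λs = searchOrder α β λs (maxLabel α β λs) 0

data Letter : Set where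
  N E : Letter

-- middle part of the border path: rows given bottom-up (increasing lengths),
-- `prev` = length of the row below (0 below the last row).
midPath : ℕ → List ℕ → List Letter
midPath prev []       = []
midPath prev (p ∷ ps) = replicate (p ∸ prev) E ++ (N ∷ midPath p ps)

firstPart : List ℕ → ℕ
firstPart []      = 0
firstPart (p ∷ _) = p

-- steps of the border path from (0, -β n) to (α n, 0), n = n_λ:
-- up the y-axis, along the lower-right boundary, then along the x-axis.
borderSteps : ℕ → ℕ → List ℕ → List Letter
borderSteps α β λs =
  replicate (β * n ∸ length λs) N ++ midPath 0 (reverse λs) ++ replicate (α * n ∸ firstPart λs) E
  where n = order α β λs

-- Lattice points of the path other than the last, with the next step.
-- A point (x , y) with y ≤ 0 is stored as (x , d) with d = - y.
walk : ℕ → ℕ → List Letter → List (ℕ × ℕ × Letter)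
walk x d []       = []
walk x d (N ∷ s)  = (x , d , N) ∷ walk x (d ∸ 1) s
walk x d (E ∷ s)  = (x , d , E) ∷ walk (suc x) d s

borderPoints : ℕ → ℕ → List ℕ → List (ℕ × ℕ × Letter)
borderPoints α β λs = walk 0 (β * order α β λs) (borderSteps α β λs)

-- level of the point (x , -d): β x - α y = β x + α d
level : ℕ → ℕ → ℕ × ℕ × Letter → ℕ
level α β (x , d , _) = β * x + α * d

letterOf : ℕ × ℕ × Letter → Letter
letterOf (_ , _ , s) = s

departure : ℕ → ℕ → List ℕ → ℕ → List Letter
departure α β λs i =
  map letterOf (filter (λ q → level α β q + i ≟ α * β * order α β λs) (borderPoints α β λs))

countN : List Letter → ℕ
countN []      = 0
countN (N ∷ w) = suc (countN w)
countN (E ∷ w) = countN w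

inv : List Letter → ℕ
inv []      = 0
inv (N ∷ w) = inv w
inv (E ∷ w) = countN w + inv w

-- Σ_{i ≥ 0} inv(w^i(λ)); w^i is empty for i > α β n_λ (levels are ≥ 0),
-- so the sum is over i = 0 … α β n_λ.
sumInv : ℕ → ℕ → List ℕ → ℕ
sumInv α β λs = sum (map (λ i → inv (departure α β λs i)) (upTo (suc (α * β * order α β λs))))

module Submission where

-- Both sides count the same pairs.  Summing inv(w^i) over the levels
-- i = 0 … αβn counts the "crossings" of the border path: pairs (E-step,
-- later N-step) starting on a common level ≤ αβn.  The north run up the
-- y-axis precedes every east step and the east run along the x-axis follows
-- every north step, so all crossings lie on the staircase along the diagram.
-- There the north step at the end of row i, on level β λ_i + α i, crosses the
-- bottom edge of column j ≤ λ_i, on level β (j - 1) + α λ'_j, exactly when the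
-- cell v = (i, j) satisfies α l_v = β (a_v + 1).  For coprime α, β this slope
-- condition implies (α + β) ∣ a_v + l_v + 1, so h counts the same pairs.

open import Defs
open import Data.Nat
open import Data.Nat.Properties
open import Data.Nat.ListAction using (sum)
open import Data.Nat.ListAction.Properties using (sum-++)
open import Data.Nat.Coprimality using (Coprime; coprime-divisor)
open import Data.Nat.Divisibility using (_∣_; divides)
open import Data.Nat.Tactic.RingSolver using (solve-∀)
open import Data.List using (List; []; _∷_; _++_; [_]; _∷ʳ_; length; filter; replicate; reverse; map; upTo; applyUpTo; foldr)
open import Data.List.Properties using (map-++; map-cong; map-∘; map-id; ++-assoc; unfold-reverse; upTo-∷ʳ; filter-accept; filter-reject)
open import Data.List.Relation.Unary.All using (All; []; _∷_; all?) renaming (map to All-map)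
open import Data.List.Relation.Unary.All.Properties using (++⁻ˡ; ++⁻ʳ; ∷ʳ⁻)
open import Data.Product using (_×_; _,_; proj₁; proj₂)
open import Data.Unit using (⊤; tt)
open import Data.Bool using (true; false)
open import Function using (_∘_; id)
open import Relation.Nullary using (Dec; yes; no; ¬_; contradiction)
open import Relation.Nullary.Decidable using (toWitness; isYes≗does; dec-true)
open import Data.Bool.Properties using (T-≡)
open import Function.Bundles using (Equivalence)
open import Relation.Unary using (Pred; Decidable)
open import Relation.Binary.PropositionalEquality using (_≡_; _≢_; refl; sym; trans; cong; cong₂; subst; module ≡-Reasoning)
open import Algebra.Properties.CommutativeSemigroup +-commutativeSemigroup using (interchange)

ind : ∀ {p} {P : Set p} → Dec P → ℕ
ind (yes _) = 1
ind (no _)  = 0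

ind-yes : ∀ {p} {P : Set p} → P → (p? : Dec P) → ind p? ≡ 1
ind-yes p (yes _) = refl
ind-yes p (no ¬p) = contradiction p ¬p

ind-no : ∀ {p} {P : Set p} → ¬ P → (p? : Dec P) → ind p? ≡ 0
ind-no ¬p (yes p) = contradiction p ¬p
ind-no ¬p (no _)  = refl

ind-cong : ∀ {p q} {P : Set p} {Q : Set q} → (P → Q) → (Q → P) →
           (p? : Dec P) (q? : Dec Q) → ind p? ≡ ind q?
ind-cong f g (yes p) (yes q) = refl
ind-cong f g (yes p) (no ¬q) = contradiction (f p) ¬q
ind-cong f g (no ¬p) (yes q) = contradiction (g q) ¬p
ind-cong f g (no ¬p) (no ¬q) = refl

Σ : ∀ {a} {A : Set a} → (A → ℕ) → List A → ℕ
Σ f xs = sum (map f xs)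

module _ {a} {A : Set a} where

  Σ-++ : ∀ (f : A → ℕ) xs ys → Σ f (xs ++ ys) ≡ Σ f xs + Σ f ys
  Σ-++ f xs ys = trans (cong sum (map-++ f xs ys)) (sum-++ (map f xs) (map f ys))

  Σ-cong : ∀ {f g : A → ℕ} → (∀ x → f x ≡ g x) → ∀ xs → Σ f xs ≡ Σ g xs
  Σ-cong f≗g xs = cong sum (map-cong f≗g xs)

  Σ-+ : ∀ (f g : A → ℕ) xs → Σ (λ x → f x + g x) xs ≡ Σ f xs + Σ g xs
  Σ-+ f g []       = refl
  Σ-+ f g (x ∷ xs) = trans (cong (f x + g x +_) (Σ-+ f g xs)) (interchange (f x) (g x) _ _)

  Σ-map : ∀ {b} {B : Set b} (f : A → ℕ) (g : B → A) xs → Σ f (map g xs) ≡ Σ (f ∘ g) xs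
  Σ-map f g xs = cong sum (sym (map-∘ xs))

  Σ-zero : ∀ xs → Σ (λ (_ : A) → 0) xs ≡ 0
  Σ-zero []       = refl
  Σ-zero (_ ∷ xs) = Σ-zero xs

  length-filter : ∀ {p} {P : Pred A p} (P? : Decidable P) xs →
                  length (filter P? xs) ≡ Σ (ind ∘ P?) xs
  length-filter P? []       = refl
  length-filter P? (x ∷ xs) with P? x
  ... | yes _ = cong suc (length-filter P? xs)
  ... | no _  = length-filter P? xs

range : ℕ → ℕ → List ℕ
range a zero    = []
range a (suc k) = a ∷ range (suc a) k

upTo≡range : ∀ k → upTo k ≡ range 0 k
upTo≡range k = trans (applyUpTo≡map id k) (map-id (range 0 k))
  where
  map-suc : ∀ a k → map suc (range a k) ≡ range (suc a) k
  map-suc a zero    = refl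
  map-suc a (suc k) = cong (suc a ∷_) (map-suc (suc a) k)

  applyUpTo≡map : (f : ℕ → ℕ) → ∀ k → applyUpTo f k ≡ map f (range 0 k)
  applyUpTo≡map f zero    = refl
  applyUpTo≡map f (suc k) = cong (f 0 ∷_) (begin
    applyUpTo (f ∘ suc) k        ≡⟨ applyUpTo≡map (f ∘ suc) k ⟩
    map (f ∘ suc) (range 0 k)    ≡⟨ map-∘ (range 0 k) ⟩
    map f (map suc (range 0 k))  ≡⟨ cong (map f) (map-suc 0 k) ⟩
    map f (range 1 k)            ∎)
    where open ≡-Reasoning

range-++ : ∀ a k m → range a (k + m) ≡ range a k ++ range (a + k) m
range-++ a zero    m = cong (λ b → range b m) (sym (+-identityʳ a))
range-++ a (suc k) m = cong (a ∷_) (trans (range-++ (suc a) k m) (cong (λ b → range (suc a) k ++ range b m) (sym (+-suc a k))))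

Σ-range-cong : ∀ {f g : ℕ → ℕ} a k → (∀ i → a ≤ i → i < a + k → f i ≡ g i) →
               Σ f (range a k) ≡ Σ g (range a k)
Σ-range-cong a zero    f≗g = refl
Σ-range-cong a (suc k) f≗g =
  cong₂ _+_ (f≗g a ≤-refl (m<m+n a z<s))
            (Σ-range-cong (suc a) k λ i a<i i<a+k → f≗g i (<⇒≤ a<i) (subst (i <_) (sym (+-suc a k)) i<a+k))

Σ-point : ∀ (g : ℕ → ℕ) t a k → a ≤ t → t < a + k → Σ (λ i → ind (i ≟ t) * g i) (range a k) ≡ g t
Σ-point g t a zero    a≤t t<a+0 = contradiction (subst (t <_) (+-identityʳ a) t<a+0) (≤⇒≯ a≤t)
Σ-point g t a (suc k) a≤t t<a+k with a ≟ t
... | yes refl = begin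
  g a + 0 + Σ (λ i → ind (i ≟ a) * g i) (range (suc a) k)
    ≡⟨ cong (g a + 0 +_) (trans (Σ-range-cong (suc a) k later) (Σ-zero (range (suc a) k))) ⟩
  g a + 0 + 0
    ≡⟨ trans (+-identityʳ _) (+-identityʳ _) ⟩
  g a ∎
  where
  open ≡-Reasoning
  later : ∀ i → suc a ≤ i → i < suc a + k → ind (i ≟ a) * g i ≡ 0
  later i a<i _ = cong (_* g i) (ind-no (λ i≡a → <⇒≢ a<i (sym i≡a)) (i ≟ a))
... | no a≢t = Σ-point g t (suc a) k (≤∧≢⇒< a≤t a≢t) (subst (t <_) (+-suc a k) t<a+k)

Σ-solution : ∀ a M (g : ℕ → ℕ) c → (a ≤ M → g (M ∸ a) ≡ c) →
             Σ (λ i → ind (a + i ≟ M) * g i) (upTo (suc M)) ≡ ind (a ≤? M) * c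
Σ-solution a M g c value with a ≤? M
... | no a≰M = trans (Σ-cong (λ i → cong (_* g i) (ind-no (λ e → a≰M (subst (a ≤_) e (m≤m+n a i))) (a + i ≟ M))) (upTo (suc M)))
                     (Σ-zero (upTo (suc M)))
... | yes a≤M = begin
  Σ (λ i → ind (a + i ≟ M) * g i) (upTo (suc M))
    ≡⟨ Σ-cong (λ i → cong (_* g i) (ind-cong (solved i) (unsolved i) (a + i ≟ M) (i ≟ M ∸ a))) (upTo (suc M)) ⟩
  Σ (λ i → ind (i ≟ M ∸ a) * g i) (upTo (suc M))
    ≡⟨ cong (Σ _) (upTo≡range (suc M)) ⟩
  Σ (λ i → ind (i ≟ M ∸ a) * g i) (range 0 (suc M))
    ≡⟨ Σ-point g (M ∸ a) 0 (suc M) z≤n (s≤s (m∸n≤m M a)) ⟩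
  g (M ∸ a)
    ≡⟨ value a≤M ⟩
  c
    ≡⟨ sym (*-identityˡ c) ⟩
  1 * c ∎
  where
  open ≡-Reasoning
  solved : ∀ i → a + i ≡ M → i ≡ M ∸ a
  solved i e = sym (trans (cong (_∸ a) (sym e)) (m+n∸m≡n a i))
  unsolved : ∀ i → i ≡ M ∸ a → a + i ≡ M
  unsolved i e = trans (cong (a +_) e) (m+[n∸m]≡n a≤M)

-- (2) Lattice paths

-- A step of a lattice path: its starting point (x , d), standing for the
-- point (x, -d), together with the letter of the step.
Step : Set
Step = ℕ × ℕ × Letter

Eastward : List Step → Set
Eastward = All (λ q → letterOf q ≡ E)

eastRun : ℕ → ℕ → ℕ → List Step
eastRun x d zero    = []
eastRun x d (suc k) = (x , d , E) ∷ eastRun (suc x) d k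

eastRun-eastward : ∀ x d k → Eastward (eastRun x d k)
eastRun-eastward x d zero    = []
eastRun-eastward x d (suc k) = refl ∷ eastRun-eastward (suc x) d k

walk-east : ∀ x d k s → walk x d (replicate k E ++ s) ≡ eastRun x d k ++ walk (x + k) d s
walk-east x d zero    s = cong (λ y → walk y d s) (sym (+-identityʳ x))
walk-east x d (suc k) s = cong ((x , d , E) ∷_)
  (trans (walk-east (suc x) d k s) (cong (λ y → eastRun (suc x) d k ++ walk y d s) (sym (+-suc x k))))

walk-east-only : ∀ x d k → walk x d (replicate k E) ≡ eastRun x d k
walk-east-only x d zero    = refl
walk-east-only x d (suc k) = cong ((x , d , E) ∷_) (walk-east-only (suc x) d k)

-- The letters of the border path along the diagram ps (rows listed top-down);
-- the path visits the rows bottom-up.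
stairs : List ℕ → List Letter
stairs ps = midPath 0 (reverse ps)

stairs-∷ : ∀ p ps → stairs (p ∷ ps) ≡ stairs ps ++ replicate (p ∸ firstPart ps) E ++ [ N ]
stairs-∷ p ps = begin
  midPath 0 (reverse (p ∷ ps))
    ≡⟨ cong (midPath 0) (unfold-reverse p ps) ⟩
  midPath 0 (reverse ps ∷ʳ p)
    ≡⟨ midPath-∷ʳ 0 (reverse ps) ⟩
  stairs ps ++ replicate (p ∸ lastRow 0 (reverse ps)) E ++ [ N ]
    ≡⟨ cong (λ r → stairs ps ++ replicate (p ∸ r) E ++ [ N ]) (lastRow-reverse ps) ⟩
  stairs ps ++ replicate (p ∸ firstPart ps) E ++ [ N ] ∎
  where
  open ≡-Reasoning
  lastRow : ℕ → List ℕ → ℕ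
  lastRow prev []       = prev
  lastRow prev (q ∷ qs) = lastRow q qs

  midPath-∷ʳ : ∀ prev qs → midPath prev (qs ∷ʳ p) ≡ midPath prev qs ++ replicate (p ∸ lastRow prev qs) E ++ [ N ]
  midPath-∷ʳ prev []       = refl
  midPath-∷ʳ prev (q ∷ qs) = trans (cong (λ w → replicate (q ∸ prev) E ++ N ∷ w) (midPath-∷ʳ q qs))
                                   (sym (++-assoc (replicate (q ∸ prev) E) (N ∷ midPath q qs) _))

  lastRow-∷ʳ : ∀ prev qs q → lastRow prev (qs ∷ʳ q) ≡ q
  lastRow-∷ʳ prev []        q = refl
  lastRow-∷ʳ prev (q′ ∷ qs) q = lastRow-∷ʳ q′ qs q

  lastRow-reverse : ∀ qs → lastRow 0 (reverse qs) ≡ firstPart qs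
  lastRow-reverse []       = refl
  lastRow-reverse (q ∷ qs) = trans (cong (lastRow 0) (unfold-reverse q qs)) (lastRow-∷ʳ 0 (reverse qs) q)

-- The steps of the border path along the diagram ps whose top row is row
-- o + 1, in the order the path takes them: first the part along the rows
-- below, then the east steps under the columns ending in row o + 1, and
-- finally the north step at the right end of row o + 1.
staircase : ℕ → List ℕ → List Step
staircase o []       = []
staircase o (p ∷ ps) =
  (staircase (suc o) ps ++ eastRun (firstPart ps) (suc o) (p ∸ firstPart ps)) ∷ʳ (p , suc o , N)

dec-tail : ∀ {p ps} → Decreasing (p ∷ ps) → Decreasing ps
dec-tail [-]     = []
dec-tail (_ ∷ d) = d

dec-head : ∀ {p ps} → Decreasing (p ∷ ps) → firstPart ps ≤ p
dec-head [-]      = z≤n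
dec-head (le ∷ _) = le

walk-stairs : ∀ o ps s → Decreasing ps →
              walk 0 (o + length ps) (stairs ps ++ s) ≡ staircase o ps ++ walk (firstPart ps) o s
walk-stairs o []       s _   = cong (λ d → walk 0 d s) (+-identityʳ o)
walk-stairs o (p ∷ ps) s dec = begin
  walk 0 (o + suc (length ps)) (stairs (p ∷ ps) ++ s)
    ≡⟨ cong₂ (walk 0) (+-suc o (length ps)) (cong (_++ s) (stairs-∷ p ps)) ⟩
  walk 0 (suc o + length ps) ((stairs ps ++ run ++ [ N ]) ++ s)
    ≡⟨ cong (walk 0 (suc o + length ps)) (trans (++-assoc (stairs ps) _ s) (cong (stairs ps ++_) (++-assoc run [ N ] s))) ⟩
  walk 0 (suc o + length ps) (stairs ps ++ run ++ N ∷ s)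
    ≡⟨ walk-stairs (suc o) ps (run ++ N ∷ s) (dec-tail dec) ⟩
  staircase (suc o) ps ++ walk (firstPart ps) (suc o) (run ++ N ∷ s)
    ≡⟨ cong (staircase (suc o) ps ++_) (walk-east (firstPart ps) (suc o) k (N ∷ s)) ⟩
  staircase (suc o) ps ++ eastRun (firstPart ps) (suc o) k ++ walk (firstPart ps + k) (suc o) (N ∷ s)
    ≡⟨ cong (λ x → staircase (suc o) ps ++ eastRun (firstPart ps) (suc o) k ++ walk x (suc o) (N ∷ s)) (m+[n∸m]≡n (dec-head dec)) ⟩
  staircase (suc o) ps ++ eastRun (firstPart ps) (suc o) k ++ (p , suc o , N) ∷ walk p o s
    ≡⟨ sym (++-assoc (staircase (suc o) ps) _ _) ⟩
  (staircase (suc o) ps ++ eastRun (firstPart ps) (suc o) k) ++ (p , suc o , N) ∷ walk p o s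
    ≡⟨ sym (++-assoc (staircase (suc o) ps ++ eastRun (firstPart ps) (suc o) k) [ (p , suc o , N) ] (walk p o s)) ⟩
  staircase o (p ∷ ps) ++ walk p o s ∎
  where
  open ≡-Reasoning
  k   = p ∸ firstPart ps
  run = replicate k E

-- (3) Levels of steps and the bottoms of columns

colLen-∷ : ∀ j p ps → j ≤ p → colLen (p ∷ ps) j ≡ suc (colLen ps j)
colLen-∷ j p ps j≤p = cong length (filter-accept (λ q → j ≤? q) j≤p)

colLen-beyond : ∀ j ps → Decreasing ps → firstPart ps < j → colLen ps j ≡ 0
colLen-beyond j []       _   _   = refl
colLen-beyond j (q ∷ qs) dec q<j =
  trans (cong length (filter-reject (λ r → j ≤? r) (<⇒≱ q<j)))
        (colLen-beyond j qs (dec-tail dec) (≤-<-trans (dec-head dec) q<j))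

module Levels (α β : ℕ) where

  lv : Step → ℕ
  lv = level α β

  nAt eAt : ℕ → List Step → ℕ
  nAt t []                    = 0
  nAt t (q@(_ , _ , N) ∷ qs) = ind (lv q ≟ t) + nAt t qs
  nAt t ((_ , _ , E) ∷ qs)   = nAt t qs

  eAt t []                    = 0
  eAt t ((_ , _ , N) ∷ qs)   = eAt t qs
  eAt t (q@(_ , _ , E) ∷ qs) = ind (lv q ≟ t) + eAt t qs

  nAt-++ : ∀ t qs rs → nAt t (qs ++ rs) ≡ nAt t qs + nAt t rs
  nAt-++ t []                    rs = refl
  nAt-++ t (q@(_ , _ , N) ∷ qs) rs = trans (cong (ind (lv q ≟ t) +_) (nAt-++ t qs rs)) (sym (+-assoc (ind (lv q ≟ t)) (nAt t qs) (nAt t rs)))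
  nAt-++ t ((_ , _ , E) ∷ qs)   rs = nAt-++ t qs rs

  eAt-++ : ∀ t qs rs → eAt t (qs ++ rs) ≡ eAt t qs + eAt t rs
  eAt-++ t []                    rs = refl
  eAt-++ t ((_ , _ , N) ∷ qs)   rs = eAt-++ t qs rs
  eAt-++ t (q@(_ , _ , E) ∷ qs) rs = trans (cong (ind (lv q ≟ t) +_) (eAt-++ t qs rs)) (sym (+-assoc (ind (lv q ≟ t)) (eAt t qs) (eAt t rs)))

  nAt-eastward : ∀ t qs → Eastward qs → nAt t qs ≡ 0
  nAt-eastward t []                  _          = refl
  nAt-eastward t ((_ , _ , E) ∷ qs) (_ ∷ east) = nAt-eastward t qs east

  eAt-eastRun : ∀ t x d k → eAt t (eastRun x d k) ≡ Σ (λ y → ind (β * y + α * d ≟ t)) (range x k)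
  eAt-eastRun t x d zero    = refl
  eAt-eastRun t x d (suc k) = cong (ind (β * x + α * d ≟ t) +_) (eAt-eastRun t (suc x) d k)

  -- The number of columns of the diagram ps, whose top row is row o + 1,
  -- with bottom edge on level t: column y + 1 ends at depth o + colLen ps (y + 1),
  -- so its bottom edge starts at the point (y, -(o + colLen ps (y + 1))).
  columnBottoms : ℕ → List ℕ → ℕ → ℕ
  columnBottoms o ps t = Σ (λ y → ind (β * y + α * (o + colLen ps (suc y)) ≟ t)) (range 0 (firstPart ps))

  -- Adding a top row p: the old columns keep their bottoms, and the new
  -- columns firstPart ps + 1, …, p have their bottoms right under the new row.
  columnBottoms-∷ : ∀ o p ps t → Decreasing (p ∷ ps) →
    columnBottoms o (p ∷ ps) t ≡ columnBottoms (suc o) ps t + eAt t (eastRun (firstPart ps) (suc o) (p ∸ firstPart ps))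
  columnBottoms-∷ o p ps t dec = begin
    Σ bottom (range 0 p)
      ≡⟨ cong (λ m → Σ bottom (range 0 m)) (sym fp+k≡p) ⟩
    Σ bottom (range 0 (fp + k))
      ≡⟨ trans (cong (Σ bottom) (range-++ 0 fp k)) (Σ-++ bottom (range 0 fp) (range fp k)) ⟩
    Σ bottom (range 0 fp) + Σ bottom (range fp k)
      ≡⟨ cong₂ _+_ (Σ-range-cong 0 fp old) (Σ-range-cong fp k new) ⟩
    columnBottoms (suc o) ps t + Σ (λ y → ind (β * y + α * suc o ≟ t)) (range fp k)
      ≡⟨ cong (columnBottoms (suc o) ps t +_) (sym (eAt-eastRun t fp (suc o) k)) ⟩
    columnBottoms (suc o) ps t + eAt t (eastRun fp (suc o) k) ∎
    where
    open ≡-Reasoning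
    fp = firstPart ps
    k  = p ∸ fp
    fp+k≡p : fp + k ≡ p
    fp+k≡p = m+[n∸m]≡n (dec-head dec)
    bottom : ℕ → ℕ
    bottom y = ind (β * y + α * (o + colLen (p ∷ ps) (suc y)) ≟ t)
    atDepth : ∀ y {c c′} → c ≡ c′ → ind (β * y + α * c ≟ t) ≡ ind (β * y + α * c′ ≟ t)
    atDepth y = cong (λ c → ind (β * y + α * c ≟ t))
    old : ∀ y → 0 ≤ y → y < fp → bottom y ≡ ind (β * y + α * (suc o + colLen ps (suc y)) ≟ t)
    old y _ y<fp = atDepth y (trans (cong (o +_) (colLen-∷ (suc y) p ps (≤-trans y<fp (dec-head dec)))) (+-suc o _))
    new : ∀ y → fp ≤ y → y < fp + k → bottom y ≡ ind (β * y + α * suc o ≟ t)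
    new y fp≤y y<fp+k = atDepth y (trans (cong (o +_) depth≡1) (+-comm o 1))
      where
      depth≡1 : colLen (p ∷ ps) (suc y) ≡ 1
      depth≡1 = trans (colLen-∷ (suc y) p ps (subst (y <_) fp+k≡p y<fp+k))
                      (cong suc (colLen-beyond (suc y) ps (dec-tail dec) (s≤s fp≤y)))

  eAt-staircase : ∀ o ps t → Decreasing ps → eAt t (staircase o ps) ≡ columnBottoms o ps t
  eAt-belowRow : ∀ o p ps t → Decreasing (p ∷ ps) →
    eAt t (staircase (suc o) ps ++ eastRun (firstPart ps) (suc o) (p ∸ firstPart ps)) ≡ columnBottoms o (p ∷ ps) t

  eAt-staircase o []       t _   = refl
  eAt-staircase o (p ∷ ps) t dec =
    trans (eAt-++ t below [ (p , suc o , N) ]) (trans (+-identityʳ (eAt t below)) (eAt-belowRow o p ps t dec))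
    where
    below = staircase (suc o) ps ++ eastRun (firstPart ps) (suc o) (p ∸ firstPart ps)

  eAt-belowRow o p ps t dec = begin
    eAt t (staircase (suc o) ps ++ run)
      ≡⟨ eAt-++ t (staircase (suc o) ps) run ⟩
    eAt t (staircase (suc o) ps) + eAt t run
      ≡⟨ cong (_+ eAt t run) (eAt-staircase (suc o) ps t (dec-tail dec)) ⟩
    columnBottoms (suc o) ps t + eAt t run
      ≡⟨ sym (columnBottoms-∷ o p ps t dec) ⟩
    columnBottoms o (p ∷ ps) t ∎
    where
    open ≡-Reasoning
    run = eastRun (firstPart ps) (suc o) (p ∸ firstPart ps)

  -- Summed over the rows: the number of column bottoms on the level of the
  -- right end corner of the row (at level β λ_i + α i for row i).
  cornerPairs : ℕ → List ℕ → ℕ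
  cornerPairs o []       = 0
  cornerPairs o (p ∷ ps) = cornerPairs (suc o) ps + columnBottoms o (p ∷ ps) (β * p + α * suc o)

-- (4) Crossings

module Crossings (α β M : ℕ) where
  open Levels α β

  crossings : List Step → ℕ
  crossings []                    = 0
  crossings ((_ , _ , N) ∷ qs)   = crossings qs
  crossings (q@(_ , _ , E) ∷ qs) = ind (lv q ≤? M) * nAt (lv q) qs + crossings qs

  -- The letters of the steps starting on level M ∸ i (written lv + i = M);
  -- on the border path with M = αβn this is the departure word w^i.
  word : ℕ → List Step → List Letter
  word i qs = map letterOf (filter (λ q → lv q + i ≟ M) qs)

  word-on : ∀ i q qs → lv q + i ≡ M → word i (q ∷ qs) ≡ letterOf q ∷ word i qs
  word-on i q qs on = cong (map letterOf) (filter-accept (λ q → lv q + i ≟ M) on)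

  word-off : ∀ i q qs → lv q + i ≢ M → word i (q ∷ qs) ≡ word i qs
  word-off i q qs off = cong (map letterOf) (filter-reject (λ q → lv q + i ≟ M) off)

  inv-word-N : ∀ i x d qs → inv (word i ((x , d , N) ∷ qs)) ≡ inv (word i qs)
  inv-word-N i x d qs with lv (x , d , N) + i ≟ M
  ... | yes on  = cong inv (word-on i _ qs on)
  ... | no off  = cong inv (word-off i _ qs off)

  inv-word-E : ∀ i x d qs → inv (word i ((x , d , E) ∷ qs)) ≡
               ind (lv (x , d , E) + i ≟ M) * countN (word i qs) + inv (word i qs)
  inv-word-E i x d qs with lv (x , d , E) + i ≟ M
  ... | yes on  = trans (cong inv (word-on i _ qs on)) (cong (_+ inv (word i qs)) (sym (+-identityʳ _)))
  ... | no off  = cong inv (word-off i _ qs off)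

  countN-word : ∀ a qs → a ≤ M → countN (word (M ∸ a) qs) ≡ nAt a qs
  countN-word a [] _ = refl
  countN-word a ((x , d , E) ∷ qs) a≤M with lv (x , d , E) + (M ∸ a) ≟ M
  ... | yes on  = trans (cong countN (word-on (M ∸ a) (x , d , E) qs on)) (countN-word a qs a≤M)
  ... | no off  = trans (cong countN (word-off (M ∸ a) (x , d , E) qs off)) (countN-word a qs a≤M)
  countN-word a ((x , d , N) ∷ qs) a≤M with lv (x , d , N) + (M ∸ a) ≟ M
  ... | yes on  = trans (cong countN (word-on (M ∸ a) (x , d , N) qs on))
                        (sym (cong₂ _+_ (ind-yes (onLevel on) (lv (x , d , N) ≟ a)) (sym (countN-word a qs a≤M))))
    where
    onLevel : lv (x , d , N) + (M ∸ a) ≡ M → lv (x , d , N) ≡ a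
    onLevel on = +-cancelʳ-≡ (M ∸ a) _ a (trans on (sym (m+[n∸m]≡n a≤M)))
  ... | no off  = trans (cong countN (word-off (M ∸ a) (x , d , N) qs off))
                        (sym (cong₂ _+_ (ind-no (off ∘ offLevel) (lv (x , d , N) ≟ a)) (sym (countN-word a qs a≤M))))
    where
    offLevel : lv (x , d , N) ≡ a → lv (x , d , N) + (M ∸ a) ≡ M
    offLevel on = trans (cong (_+ (M ∸ a)) on) (m+[n∸m]≡n a≤M)

  -- Σ_{i ≤ M} inv(word i) counts the crossings: each E-step pairs with the
  -- later N-steps of its own level, provided that level is ≤ M.
  levelSum : ∀ qs → Σ (λ i → inv (word i qs)) (upTo (suc M)) ≡ crossings qs
  levelSum [] = Σ-zero (upTo (suc M))
  levelSum ((x , d , N) ∷ qs) = trans (Σ-cong (λ i → inv-word-N i x d qs) (upTo (suc M))) (levelSum qs)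
  levelSum ((x , d , E) ∷ qs) = begin
    Σ (λ i → inv (word i ((x , d , E) ∷ qs))) (upTo (suc M))
      ≡⟨ Σ-cong (λ i → inv-word-E i x d qs) (upTo (suc M)) ⟩
    Σ (λ i → ind (a + i ≟ M) * countN (word i qs) + inv (word i qs)) (upTo (suc M))
      ≡⟨ Σ-+ (λ i → ind (a + i ≟ M) * countN (word i qs)) (λ i → inv (word i qs)) (upTo (suc M)) ⟩
    Σ (λ i → ind (a + i ≟ M) * countN (word i qs)) (upTo (suc M)) + Σ (λ i → inv (word i qs)) (upTo (suc M))
      ≡⟨ cong₂ _+_ (Σ-solution a M (λ i → countN (word i qs)) (nAt a qs) (countN-word a qs)) (levelSum qs) ⟩
    ind (a ≤? M) * nAt a qs + crossings qs ∎
    where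
    open ≡-Reasoning
    a = lv (x , d , E)

  crossings-++-eastward : ∀ qs rs → Eastward rs → crossings (qs ++ rs) ≡ crossings qs
  crossings-++-eastward [] [] _ = refl
  crossings-++-eastward [] (q@(_ , _ , E) ∷ rs) (_ ∷ east) = begin
    ind (lv q ≤? M) * nAt (lv q) rs + crossings rs
      ≡⟨ cong₂ (λ u v → ind (lv q ≤? M) * u + v) (nAt-eastward (lv q) rs east) (crossings-++-eastward [] rs east) ⟩
    ind (lv q ≤? M) * 0 + 0
      ≡⟨ trans (+-identityʳ _) (*-zeroʳ (ind (lv q ≤? M))) ⟩
    0 ∎
    where open ≡-Reasoning
  crossings-++-eastward ((_ , _ , N) ∷ qs) rs east = crossings-++-eastward qs rs east
  crossings-++-eastward (q@(_ , _ , E) ∷ qs) rs east =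
    cong₂ (λ u v → ind (lv q ≤? M) * u + v)
      (trans (nAt-++ (lv q) qs rs) (trans (cong (nAt (lv q) qs +_) (nAt-eastward (lv q) rs east)) (+-identityʳ _)))
      (crossings-++-eastward qs rs east)

  level-cap : ∀ a t → t ≤ M → ind (a ≤? M) * ind (t ≟ a) ≡ ind (a ≟ t)
  level-cap a t t≤M with t ≟ a
  ... | yes refl = trans (cong (_* 1) (ind-yes t≤M (a ≤? M))) (sym (ind-yes refl (a ≟ a)))
  ... | no t≢a  = trans (*-zeroʳ (ind (a ≤? M))) (sym (ind-no (t≢a ∘ sym) (a ≟ t)))

  crossings-∷ʳ-N : ∀ qs x d → lv (x , d , N) ≤ M →
                   crossings (qs ∷ʳ (x , d , N)) ≡ crossings qs + eAt (lv (x , d , N)) qs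
  crossings-∷ʳ-N []                    x d _   = refl
  crossings-∷ʳ-N ((_ , _ , N) ∷ qs)   x d t≤M = crossings-∷ʳ-N qs x d t≤M
  crossings-∷ʳ-N (q@(_ , _ , E) ∷ qs) x d t≤M = begin
    A * nAt (lv q) (qs ∷ʳ (x , d , N)) + crossings (qs ∷ʳ (x , d , N))
      ≡⟨ cong₂ (λ u v → A * u + v) (nAt-++ (lv q) qs _) (crossings-∷ʳ-N qs x d t≤M) ⟩
    A * (nAt (lv q) qs + (ind (t ≟ lv q) + 0)) + (crossings qs + eAt t qs)
      ≡⟨ rearrange A (nAt (lv q) qs) (ind (t ≟ lv q) + 0) (crossings qs) (eAt t qs) ⟩
    A * nAt (lv q) qs + crossings qs + (A * (ind (t ≟ lv q) + 0) + eAt t qs)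
      ≡⟨ cong (λ u → A * nAt (lv q) qs + crossings qs + (u + eAt t qs))
              (trans (cong (A *_) (+-identityʳ _)) (level-cap (lv q) t t≤M)) ⟩
    A * nAt (lv q) qs + crossings qs + (ind (lv q ≟ t) + eAt t qs) ∎
    where
    open ≡-Reasoning
    A = ind (lv q ≤? M)
    t = lv (x , d , N)
    rearrange : ∀ a n e c f → a * (n + e) + (c + f) ≡ a * n + c + (a * e + f)
    rearrange = solve-∀


  crossings-north : ∀ x d m s → crossings (walk x d (replicate m N ++ s)) ≡ crossings (walk x (d ∸ m) s)
  crossings-north x d zero    s = refl
  crossings-north x d (suc m) s =
    trans (crossings-north x (d ∸ 1) m s) (cong (λ e → crossings (walk x e s)) (∸-+-assoc d 1 m))

  -- Only the staircase contributes crossings to the border path: the north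
  -- run up the y-axis comes first and the east run along the x-axis comes last.
  crossings-border : ∀ λs → Decreasing λs → length λs ≤ β * order α β λs →
                     crossings (borderPoints α β λs) ≡ crossings (staircase 0 λs)
  crossings-border λs dec ℓ≤βn = begin
    crossings (walk 0 (β * n) (replicate (β * n ∸ ℓ) N ++ stairs λs ++ alongX))
      ≡⟨ crossings-north 0 (β * n) (β * n ∸ ℓ) (stairs λs ++ alongX) ⟩
    crossings (walk 0 (β * n ∸ (β * n ∸ ℓ)) (stairs λs ++ alongX))
      ≡⟨ cong (λ d → crossings (walk 0 d (stairs λs ++ alongX))) (m∸[m∸n]≡n ℓ≤βn) ⟩
    crossings (walk 0 ℓ (stairs λs ++ alongX))
      ≡⟨ cong crossings (walk-stairs 0 λs alongX dec) ⟩
    crossings (staircase 0 λs ++ walk (firstPart λs) 0 alongX)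
      ≡⟨ crossings-++-eastward (staircase 0 λs) _ east ⟩
    crossings (staircase 0 λs) ∎
    where
    open ≡-Reasoning
    n = order α β λs
    ℓ = length λs
    alongX = replicate (α * n ∸ firstPart λs) E
    east : Eastward (walk (firstPart λs) 0 alongX)
    east = subst Eastward (sym (walk-east-only (firstPart λs) 0 _)) (eastRun-eastward (firstPart λs) 0 _)

  CornersBelow : ℕ → List ℕ → Set
  CornersBelow o []       = ⊤
  CornersBelow o (p ∷ ps) = β * p + α * suc o ≤ M × CornersBelow (suc o) ps

  -- The north step at the corner of each row crosses the column bottoms on its level.
  crossings-staircase : ∀ o ps → Decreasing ps → CornersBelow o ps → crossings (staircase o ps) ≡ cornerPairs o ps
  crossings-staircase o []       _   _                    = refl
  crossings-staircase o (p ∷ ps) dec (corner≤M , corners) = begin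
    crossings (below ∷ʳ (p , suc o , N))
      ≡⟨ crossings-∷ʳ-N below p (suc o) corner≤M ⟩
    crossings below + eAt t below
      ≡⟨ cong₂ _+_ (crossings-++-eastward (staircase (suc o) ps) run (eastRun-eastward _ (suc o) _))
                   (eAt-belowRow o p ps t dec) ⟩
    crossings (staircase (suc o) ps) + columnBottoms o (p ∷ ps) t
      ≡⟨ cong (_+ columnBottoms o (p ∷ ps) t) (crossings-staircase (suc o) ps (dec-tail dec) corners) ⟩
    cornerPairs o (p ∷ ps) ∎
    where
    open ≡-Reasoning
    t     = β * p + α * suc o
    run   = eastRun (firstPart ps) (suc o) (p ∸ firstPart ps)
    below = staircase (suc o) ps ++ run

-- (5) Hook cells, row by row

-- For coprime α, β the slope condition α l = β (a + 1) of h already implies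
-- its divisibility condition (α + β) ∣ a + l + 1: α ∣ a + 1, say a + 1 = t α,
-- hence l = β t and a + l + 1 = t (α + β).
slope⇒divisible : ∀ α β → 0 < α → Coprime α β → ∀ a l → α * l ≡ β * (a + 1) → (α + β) ∣ a + l + 1
slope⇒divisible α β α>0 cop a l slope with coprime-divisor cop (divides l (trans (sym slope) (*-comm α l)))
... | divides t a+1≡tα = divides t (begin
  a + l + 1      ≡⟨ reorder a l ⟩
  a + 1 + l      ≡⟨ cong₂ _+_ a+1≡tα l≡βt ⟩
  t * α + β * t  ≡⟨ collect t α β ⟩
  t * (α + β)    ∎)
  where
  open ≡-Reasoning
  reorder : ∀ a l → a + l + 1 ≡ a + 1 + l
  reorder = solve-∀
  swap : ∀ α β t → β * (t * α) ≡ α * (β * t)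
  swap = solve-∀
  collect : ∀ t α β → t * α + β * t ≡ t * (α + β)
  collect = solve-∀
  l≡βt : l ≡ β * t
  l≡βt = *-cancelˡ-≡ l (β * t) α {{>-nonZero α>0}}
           (trans slope (trans (cong (β *_) a+1≡tα) (swap α β t)))

-- ps lists the rows o + 1, o + 2, … of the diagram Λ.
record Suffix (Λ : List ℕ) (o : ℕ) (ps : List ℕ) : Set where
  field
    rows : ∀ k → rowLen Λ (suc o + k) ≡ rowLen ps (suc k)
    cols : ∀ y → suc y ≤ firstPart ps → colLen Λ (suc y) ≡ o + colLen ps (suc y)

suffix-self : ∀ Λ → Suffix Λ 0 Λ
suffix-self Λ = record { rows = λ _ → refl ; cols = λ _ _ → refl }

suffix-tail : ∀ {Λ o p ps} → Decreasing (p ∷ ps) → Suffix Λ o (p ∷ ps) → Suffix Λ (suc o) ps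
suffix-tail {Λ} {o} {p} {ps} dec sfx = record
  { rows = λ k → trans (cong (rowLen Λ) (sym (+-suc (suc o) k))) (rows (suc k))
  ; cols = λ y y<fp → let y<p = ≤-trans y<fp (dec-head dec) in
      trans (cols y y<p) (trans (cong (o +_) (colLen-∷ (suc y) p ps y<p)) (+-suc o _))
  }
  where open Suffix sfx

-- Both sides of the slope condition, shifted by the level β y + α (o + 1).
depth-split : ∀ α β y o c → β * y + α * (o + suc c) ≡ (β * y + α * suc o) + α * c
depth-split = solve-∀

corner-split : ∀ α β y o r → β * (suc y + r) + α * suc o ≡ (β * y + α * suc o) + β * (r + 1)
corner-split = solve-∀

module Hooks (α β : ℕ) where
  open Levels α β

  hookInd : List ℕ → ℕ × ℕ → ℕ
  hookInd Λ v = ind (α * leg Λ v ≟ β * (arm Λ v + 1))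

  h≡Σhook : 0 < α → Coprime α β → ∀ Λ → h α β Λ ≡ Σ (hookInd Λ) (cells Λ)
  h≡Σhook α>0 cop Λ = trans (length-filter (hCond? α β Λ) (cells Λ)) (Σ-cong same (cells Λ))
    where
    same : ∀ v → ind (hCond? α β Λ v) ≡ hookInd Λ v
    same v = ind-cong proj₁ (λ slope → slope , slope⇒divisible α β α>0 cop (arm Λ v) (leg Λ v) slope)
                      (hCond? α β Λ v) (α * leg Λ v ≟ β * (arm Λ v + 1))

  -- The cell of row o + 1 (of length p) in column y + 1, with arm r and leg c,
  -- satisfies the slope condition iff the bottom edge of its column is level
  -- with the right end corner of its row.
  hookInd-row : ∀ Λ o p ps y → Suffix Λ o (p ∷ ps) → y < p →
    hookInd Λ (suc o , suc y) ≡ ind (β * y + α * (o + colLen (p ∷ ps) (suc y)) ≟ β * p + α * suc o)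
  hookInd-row Λ o p ps y sfx y<p = begin
    hookInd Λ (suc o , suc y)
      ≡⟨ cong₂ (λ l a → ind (α * l ≟ β * (a + 1))) leg≡c arm≡r ⟩
    ind (α * c ≟ β * (r + 1))
      ≡⟨ ind-cong slope⇒level level⇒slope (α * c ≟ β * (r + 1)) (β * y + α * (o + suc c) ≟ β * (suc y + r) + α * suc o) ⟩
    ind (β * y + α * (o + suc c) ≟ β * (suc y + r) + α * suc o)
      ≡⟨ cong₂ (λ u v → ind (β * y + α * (o + u) ≟ β * v + α * suc o)) (sym col≡) (m+[n∸m]≡n y<p) ⟩
    ind (β * y + α * (o + colLen (p ∷ ps) (suc y)) ≟ β * p + α * suc o) ∎
    where
    open ≡-Reasoning
    open Suffix sfx
    c = colLen ps (suc y)
    r = p ∸ suc y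
    K = β * y + α * suc o
    col≡ : colLen (p ∷ ps) (suc y) ≡ suc c
    col≡ = colLen-∷ (suc y) p ps y<p
    leg≡c : colLen Λ (suc y) ∸ suc o ≡ c
    leg≡c = trans (cong (_∸ suc o) (trans (cols y y<p) (trans (cong (o +_) col≡) (+-suc o c)))) (m+n∸m≡n (suc o) c)
    arm≡r : rowLen Λ (suc o) ∸ suc y ≡ r
    arm≡r = cong (_∸ suc y) (trans (cong (rowLen Λ) (sym (+-identityʳ (suc o)))) (rows 0))
    slope⇒level : α * c ≡ β * (r + 1) → β * y + α * (o + suc c) ≡ β * (suc y + r) + α * suc o
    slope⇒level slope = trans (depth-split α β y o c) (trans (cong (K +_) slope) (sym (corner-split α β y o r)))
    level⇒slope : β * y + α * (o + suc c) ≡ β * (suc y + r) + α * suc o → α * c ≡ β * (r + 1)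
    level⇒slope level = +-cancelˡ-≡ K _ _ (trans (sym (depth-split α β y o c)) (trans level (corner-split α β y o r)))

  hookRow : ∀ Λ o p ps → Suffix Λ o (p ∷ ps) →
            Σ (hookInd Λ) (rowCells (suc o) p) ≡ columnBottoms o (p ∷ ps) (β * p + α * suc o)
  hookRow Λ o p ps sfx = begin
    Σ (hookInd Λ) (map (λ j → (suc o , suc j)) (upTo p))
      ≡⟨ Σ-map (hookInd Λ) (λ j → (suc o , suc j)) (upTo p) ⟩
    Σ (λ y → hookInd Λ (suc o , suc y)) (upTo p)
      ≡⟨ cong (Σ _) (upTo≡range p) ⟩
    Σ (λ y → hookInd Λ (suc o , suc y)) (range 0 p)
      ≡⟨ Σ-range-cong 0 p (λ y _ y<p → hookInd-row Λ o p ps y sfx y<p) ⟩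
    columnBottoms o (p ∷ ps) (β * p + α * suc o) ∎
    where open ≡-Reasoning

  hookSum : ∀ Λ o ps → Decreasing ps → Suffix Λ o ps → Σ (hookInd Λ) (cellsFrom (suc o) ps) ≡ cornerPairs o ps
  hookSum Λ o []       _   _   = refl
  hookSum Λ o (p ∷ ps) dec sfx = begin
    Σ (hookInd Λ) (rowCells (suc o) p ++ cellsFrom (suc (suc o)) ps)
      ≡⟨ Σ-++ (hookInd Λ) (rowCells (suc o) p) _ ⟩
    Σ (hookInd Λ) (rowCells (suc o) p) + Σ (hookInd Λ) (cellsFrom (suc (suc o)) ps)
      ≡⟨ +-comm (Σ (hookInd Λ) (rowCells (suc o) p)) _ ⟩
    Σ (hookInd Λ) (cellsFrom (suc (suc o)) ps) + Σ (hookInd Λ) (rowCells (suc o) p)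
      ≡⟨ cong₂ _+_ (hookSum Λ (suc o) ps (dec-tail dec) (suffix-tail dec sfx)) (hookRow Λ o p ps sfx) ⟩
    cornerPairs o (p ∷ ps) ∎
    where open ≡-Reasoning

-- (6) Bounds coming from the order n_λ

≤-foldr-⊔ : ∀ {a} {A : Set a} (f : A → ℕ) xs → All (λ x → f x ≤ foldr (λ x m → f x ⊔ m) 0 xs) xs
≤-foldr-⊔ f []       = []
≤-foldr-⊔ f (x ∷ xs) = m≤m⊔n (f x) _ ∷ All-map (λ le → ≤-trans le (m≤n⊔m (f x) _)) (≤-foldr-⊔ f xs)

rowCells-∷ʳ : ∀ i p → rowCells i (suc p) ≡ rowCells i p ∷ʳ (i , suc p)
rowCells-∷ʳ i p = trans (cong (map (λ j → (i , suc j))) (sym (upTo-∷ʳ p))) (map-++ _ (upTo p) [ p ])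

module Order (α β : ℕ) (α>0 : 0 < α) (β>0 : 0 < β) (λs : List ℕ) where
  open Crossings

  n M : ℕ
  n = order α β λs
  M = α * β * n

  search-sound : ∀ fuel s → labelsBelow α β λs (fuel + s) ≡ true →
                 labelsBelow α β λs (searchOrder α β λs fuel s) ≡ true
  search-sound zero       s ok = ok
  search-sound (suc fuel) s ok with labelsBelow α β λs s in eq
  ... | true  = eq
  ... | false = search-sound fuel (suc s) (subst (λ m → labelsBelow α β λs m ≡ true) (sym (+-suc fuel s)) ok)

  -- Every cell has label ≤ M: the range of the search contains maxLabel,
  -- which bounds all labels.
  labels≤M : All (λ v → label α β v ≤ M) (cells λs)
  labels≤M = toWitness (Equivalence.from T-≡ (search-sound top 0 (subst (λ m → labelsBelow α β λs m ≡ true) (sym (+-identityʳ top)) top-works)))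
    where
    top = maxLabel α β λs
    instance
      αβ≢0 : NonZero (α * β)
      αβ≢0 = m*n≢0 α β {{>-nonZero α>0}} {{>-nonZero β>0}}
    bounded? = all? (λ v → label α β v ≤? α * β * top) (cells λs)
    top-works : labelsBelow α β λs top ≡ true
    top-works = trans (isYes≗does bounded?) (dec-true bounded? (All-map (λ le → ≤-trans le (m≤n*m top (α * β))) (≤-foldr-⊔ (label α β) (cells λs))))

  -- The right end of each row is a cell, so every corner lies on a level ≤ M.
  corners≤M : ∀ o ps → All (1 ≤_) ps → All (λ v → label α β v ≤ M) (cellsFrom (suc o) ps) → CornersBelow α β M o ps
  corners≤M o []            _         _      = tt
  corners≤M o (suc p ∷ ps) (_ ∷ pos) labels =
    subst (_≤ M) (+-comm (α * suc o) (β * suc p)) (proj₂ (∷ʳ⁻ (subst (All _) (rowCells-∷ʳ (suc o) p) (++⁻ˡ (rowCells (suc o) (suc p)) labels)))) ,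
    corners≤M (suc o) ps pos (++⁻ʳ (rowCells (suc o) (suc p)) labels)

  rows≤βn : ∀ o ps → All (1 ≤_) ps → CornersBelow α β M o ps → o ≤ β * n → o + length ps ≤ β * n
  rows≤βn o []       _           _                   o≤βn = subst (_≤ β * n) (sym (+-identityʳ o)) o≤βn
  rows≤βn o (p ∷ ps) (p≥1 ∷ pos) (corner≤M , corners) _    =
    subst (_≤ β * n) (sym (+-suc o (length ps))) (rows≤βn (suc o) ps pos corners (<⇒≤ (*-cancelˡ-< α (suc o) (β * n) lt)))
    where
    lt : α * suc o < α * (β * n)
    lt = begin-strict
      α * suc o          <⟨ m<n+m (α * suc o) (*-mono-≤ β>0 p≥1) ⟩
      β * p + α * suc o  ≤⟨ corner≤M ⟩
      α * β * n          ≡⟨ *-assoc α β n ⟩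
      α * (β * n)        ∎
      where open ≤-Reasoning

open Levels using (cornerPairs)
open Crossings using (crossings; levelSum; crossings-border; crossings-staircase)
open Hooks using (hookInd; h≡Σhook; hookSum)

proposition3p9 : (α β : ℕ) → 0 < α → 0 < β → Coprime α β →
    (λs : List ℕ) → IsPartition λs →
    h α β λs ≡ sumInv α β λs
proposition3p9 α β α>0 β>0 cop λs (dec , positive) = begin
  h α β λs                                ≡⟨ h≡Σhook α β α>0 cop λs ⟩
  Σ (hookInd α β λs) (cells λs)           ≡⟨ hookSum α β λs 0 λs dec (suffix-self λs) ⟩
  cornerPairs α β 0 λs                    ≡⟨ sym (crossings-staircase α β M 0 λs dec corners) ⟩
  crossings α β M (staircase 0 λs)        ≡⟨ sym (crossings-border α β M λs dec (rows≤βn 0 λs positive corners z≤n)) ⟩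
  crossings α β M (borderPoints α β λs)   ≡⟨ sym (levelSum α β M (borderPoints α β λs)) ⟩
  sumInv α β λs                           ∎
  where
  open ≡-Reasoning
  open Order α β α>0 β>0 λs using (M; labels≤M; corners≤M; rows≤βn)
  corners = corners≤M 0 λs positive labels≤M
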